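{- For every positive integer $n$, the number of $n\times n$ magog matrices $A=(a_{ij})$ with $a_{11}=1$ or $a_{21}=1$ is the Catalan number $\frac{1}{n+1}\binom{2n}{n}$.
   Context: An $n\times n$ magog matrix is an $n\times n$ matrix $A=(a_{ij})$ with entries in $\{0,1,-1\}$ such that all row sums and all column sums equal $1$, $0\le \sum_{i'=1}^{i}a_{i'j}\le 1$ for all $1\le i,j\le n$, $\sum_{j'=1}^{j}a_{ij'}\ge 0$ for all $1\le i,j\le n$, and for all $1\le i\le n-2$, $1\le j\le n-2$, $$\sum_{j'=1}^{j}a_{i+1,j'}+\sum_{i'=1}^{i+1}a_{i',j+1}-\sum_{i'=1}^{i}a_{i'j}\ge 0.$$ -}

module Defs where

open import Data.Nat using (ℕ; zero; suc; _∸_)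
open import Data.Integer using (ℤ; +_; _+_; _-_)
open import Data.Vec using (Vec; []; _∷_; replicate)

-- n×n integer matrices, stored as a vector of rows
Matrix : ℕ → Set
Matrix n = Vec (Vec ℤ n) n

getD : {A : Set} {m : ℕ} → A → Vec A m → ℕ → A
getD d []       _       = d
getD d (x ∷ xs) zero    = x
getD d (x ∷ xs) (suc k) = getD d xs k

-- 1-indexed entry a_{ij}; out of range (i or j = 0 or > n) gives 0
entry : {n : ℕ} → Matrix n → ℕ → ℕ → ℤ
entry A zero    _       = + 0
entry A (suc i) zero    = + 0
entry {n} A (suc i) (suc j) = getD (+ 0) (getD (replicate n (+ 0)) A i) j

sumTo : ℕ → (ℕ → ℤ) → ℤ
sumTo zero    f = + 0
sumTo (suc m) f = sumTo m f + f (suc m)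

rowPS : {n : ℕ} → Matrix n → ℕ → ℕ → ℤ
rowPS A i j = sumTo j (λ j' → entry A i j')

colPS : {n : ℕ} → Matrix n → ℕ → ℕ → ℤ
colPS A i j = sumTo i (λ i' → entry A i' j)

-- A magog matrix with a₁₁ = 1 or a₂₁ = 1 is determined by its column partial sums c i j, which lie
-- in {0, 1}. Row i of c sums to i, and an induction on i, started by a₁₁ = 1 or a₂₁ = 1 and driven
-- by the magog inequality, shows that it has ones in columns 1, …, i − 1; so row i is this run of
-- ones and a single further one in some column X i ≥ i. Conversely, a sequence with i ≤ X i ≤ n
-- gives a magog matrix exactly when X (i + 1) ≤ X i + 1, and then a₁₁ = 1 (if X 1 = 1) or a₂₁ = 1.
-- The offsets X i − i form a weakly decreasing sequence whose (t + 1)-st term is at most n − 1 − t;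
-- these are counted by the ballot recurrence, giving the Catalan number C(2n, n)/(n + 1).

module Submission where

open import Defs
open import Data.Nat using (ℕ; zero; suc; pred; _+_; _*_; _∸_; _/_; _⊓_; _≤_; _<_; z≤n; s≤s; s≤s⁻¹; _≤?_; _<?_; _≟_)
open import Data.Nat.Properties
open import Data.Nat.Combinatorics using (_C_; nCk+nC[k+1]≡[n+1]C[k+1]; nCk≡nC[n∸k]; k>n⇒nCk≡0; nC1≡n)
open import Data.Nat.DivMod using (m*n/n≡m)
open import Data.Nat.Tactic.RingSolver using (solve-∀)
open import Data.Integer using (ℤ; +_; -[1+_]; ∣_∣; +≤+) renaming (_+_ to _+ℤ_; _-_ to _-ℤ_; _≤_ to _≤ℤ_)
import Data.Integer.Properties as ℤ
import Data.Integer.Tactic.RingSolver as ℤ-Solver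
open import Data.Vec using (Vec; []; _∷_; replicate)
open import Data.List using (List; []; _∷_; map; _++_; length; applyUpTo)
open import Data.List.Properties using (length-map; length-++; ∷-injectiveʳ)
open import Data.List.Membership.Propositional using (_∈_)
open import Data.List.Membership.Propositional.Properties using (∈-map⁺; ∈-map⁻; ∈-++⁺ˡ; ∈-++⁺ʳ; ∈-++⁻)
open import Data.List.Relation.Unary.Any using (here; there)
import Data.List.Relation.Unary.All as All
import Data.List.Relation.Unary.All.Properties as All
open import Data.List.Relation.Unary.AllPairs using ([]; _∷_)
open import Data.List.Relation.Unary.Unique.Propositional using (Unique)
open import Data.List.Relation.Unary.Unique.Propositional.Properties using (map⁺; ++⁺)
open import Data.Empty using (⊥)
open import Data.Product using (Σ; _×_; _,_; proj₁; proj₂)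
open import Data.Sum using (_⊎_; inj₁; inj₂; [_,_]′)
open import Function using (_∘_; _$_)
open import Function.Bundles using (_⇔_; mk⇔)
open import Relation.Nullary using (Dec; yes; no; ¬_; contradiction)
open import Relation.Binary.PropositionalEquality

-- Ballot numbers

[k+1]*[n+1]C[k+1]≡[n+1]*nCk : ∀ n k → suc k * (suc n C suc k) ≡ suc n * (n C k)
[k+1]*[n+1]C[k+1]≡[n+1]*nCk zero    zero    = refl
[k+1]*[n+1]C[k+1]≡[n+1]*nCk zero    (suc k) =
  trans (cong (suc (suc k) *_) (k>n⇒nCk≡0 (s≤s (s≤s (z≤n {k}))))) (*-zeroʳ (suc (suc k)))
[k+1]*[n+1]C[k+1]≡[n+1]*nCk (suc n) zero    =
  trans (+-identityʳ (suc (suc n) C 1)) (trans (nC1≡n (suc (suc n))) (sym (*-identityʳ (suc (suc n)))))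
[k+1]*[n+1]C[k+1]≡[n+1]*nCk (suc n) (suc k) = begin
  suc (suc k) * (suc (suc n) C suc (suc k))
    ≡⟨ cong (suc (suc k) *_) (nCk+nC[k+1]≡[n+1]C[k+1] (suc n) (suc k)) ⟨
  suc (suc k) * (p + q)                                 ≡⟨ expand (suc k) p q ⟩
  suc k * p + p + suc (suc k) * q
    ≡⟨ cong₂ (λ x y → x + p + y) ([k+1]*[n+1]C[k+1]≡[n+1]*nCk n k) ([k+1]*[n+1]C[k+1]≡[n+1]*nCk n (suc k)) ⟩
  suc n * (n C k) + p + suc n * (n C suc k)              ≡⟨ collect n (n C k) (n C suc k) p ⟩
  suc n * (n C k + n C suc k) + p                       ≡⟨ cong (λ x → suc n * x + p) (nCk+nC[k+1]≡[n+1]C[k+1] n k) ⟩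
  suc n * p + p                                         ≡⟨ +-comm (suc n * p) p ⟩
  suc (suc n) * p                                       ∎
  where
  open ≡-Reasoning
  p = suc n C suc k
  q = suc n C suc (suc k)
  expand : ∀ k p q → suc k * (p + q) ≡ k * p + p + suc k * q
  expand = solve-∀
  collect : ∀ n x y p → suc n * x + p + suc n * y ≡ suc n * (x + y) + p
  collect = solve-∀

[k+r]Ck≡[k+r]Cr : ∀ k r → (k + r) C k ≡ (k + r) C r
[k+r]Ck≡[k+r]Cr k r = trans (nCk≡nC[n∸k] (m≤m+n k r)) (cong ((k + r) C_) (m+n∸m≡n k r))

[k+1]*[k+r+1]C[k+1]≡[r+1]*[k+r+1]Ck : ∀ k r → suc k * ((k + suc r) C suc k) ≡ suc r * ((k + suc r) C k)
[k+1]*[k+r+1]C[k+1]≡[r+1]*[k+r+1]Ck k r = begin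
  suc k * ((k + suc r) C suc k)     ≡⟨ cong (λ N → suc k * (N C suc k)) (+-suc k r) ⟩
  suc k * (suc (k + r) C suc k)     ≡⟨ [k+1]*[n+1]C[k+1]≡[n+1]*nCk (k + r) k ⟩
  suc (k + r) * ((k + r) C k)       ≡⟨ cong (suc (k + r) *_) ([k+r]Ck≡[k+r]Cr k r) ⟩
  suc (k + r) * ((k + r) C r)       ≡⟨ [k+1]*[n+1]C[k+1]≡[n+1]*nCk (k + r) r ⟨
  suc r * (suc (k + r) C suc r)     ≡⟨ cong (λ N → suc r * (N C suc r)) (+-suc k r) ⟨
  suc r * ((k + suc r) C suc r)     ≡⟨ cong (suc r *_) ([k+r]Ck≡[k+r]Cr k (suc r)) ⟨
  suc r * ((k + suc r) C k)         ∎
  where open ≡-Reasoning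

Descending : ℕ → ℕ → List ℕ → Set
Descending zero    b ys       = ys ≡ []
Descending (suc m) b []       = ⊥
Descending (suc m) b (y ∷ ys) = y ≤ b × y ≤ m × Descending m y ys

Descending-weaken : ∀ {m b} ys → Descending (suc m) b ys → Descending (suc m) (suc b) ys
Descending-weaken (y ∷ ys) (y≤b , y≤m , rest) = m≤n⇒m≤1+n y≤b , y≤m , rest

-- Once m ≤ b the bound b is implied by y₀ ≤ m ∸ 1 and can be lowered.
descending : ℕ → ℕ → List (List ℕ)
descending zero    b       = [] ∷ []
descending (suc m) zero    = map (0 ∷_) (descending m 0)
descending (suc m) (suc b) with m ≤? b
... | yes _ = descending (suc m) b
... | no  _ = descending (suc m) b ++ map (suc b ∷_) (descending m (suc b))

∈-descending⁻ : ∀ m b {ys} → ys ∈ descending m b → Descending m b ys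
∈-descending⁻ zero    b       (here refl) = refl
∈-descending⁻ (suc m) zero    ys∈ with ∈-map⁻ (0 ∷_) ys∈
... | zs , zs∈ , refl = z≤n , z≤n , ∈-descending⁻ m 0 zs∈
∈-descending⁻ (suc m) (suc b) {ys} ys∈ with m ≤? b
... | yes _ = Descending-weaken ys (∈-descending⁻ (suc m) b ys∈)
... | no m≰b with ∈-++⁻ (descending (suc m) b) ys∈
...   | inj₁ ys∈ˡ = Descending-weaken ys (∈-descending⁻ (suc m) b ys∈ˡ)
...   | inj₂ ys∈ʳ with ∈-map⁻ (suc b ∷_) ys∈ʳ
...     | zs , zs∈ , refl = ≤-refl , ≰⇒> m≰b , ∈-descending⁻ m (suc b) zs∈

∈-descending⁺ : ∀ m b {ys} → Descending m b ys → ys ∈ descending m b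
∈-descending⁺ zero    b       refl = here refl
∈-descending⁺ (suc m) zero    {y ∷ ys} (z≤n , _ , rest) = ∈-map⁺ (0 ∷_) (∈-descending⁺ m 0 rest)
∈-descending⁺ (suc m) (suc b) {y ∷ ys} (y≤1+b , y≤m , rest) with m ≤? b
... | yes m≤b = ∈-descending⁺ (suc m) b (≤-trans y≤m m≤b , y≤m , rest)
... | no _ with y ≤? b
...   | yes y≤b = ∈-++⁺ˡ (∈-descending⁺ (suc m) b (y≤b , y≤m , rest))
...   | no y≰b with ≤-antisym y≤1+b (≰⇒> y≰b)
...     | refl = ∈-++⁺ʳ (descending (suc m) b) (∈-map⁺ (suc b ∷_) (∈-descending⁺ m (suc b) rest))

descending-unique : ∀ m b → Unique (descending m b)
descending-unique zero    b       = All.[] ∷ []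
descending-unique (suc m) zero    = map⁺ ∷-injectiveʳ (descending-unique m 0)
descending-unique (suc m) (suc b) with m ≤? b
... | yes _ = descending-unique (suc m) b
... | no  _ = ++⁺ (descending-unique (suc m) b) (map⁺ ∷-injectiveʳ (descending-unique m (suc b))) disjoint
  where
  disjoint : ∀ {ys} → ¬ (ys ∈ descending (suc m) b × ys ∈ map (suc b ∷_) (descending m (suc b)))
  disjoint (ys∈ˡ , ys∈ʳ) with ∈-map⁻ (suc b ∷_) ys∈ʳ
  ... | _ , _ , refl with ∈-descending⁻ (suc m) b ys∈ˡ
  ...   | 1+b≤b , _ = <-irrefl refl 1+b≤b

length-descending-0 : ∀ m → length (descending m 0) ≡ 1
length-descending-0 zero    = refl
length-descending-0 (suc m) = trans (length-map (0 ∷_) (descending m 0)) (length-descending-0 m)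

length-descending-≤ : ∀ {m b} → m ≤ b → length (descending (suc m) (suc b)) ≡ length (descending (suc m) b)
length-descending-≤ {m} {b} m≤b with m ≤? b
... | yes _   = refl
... | no  m≰b = contradiction m≤b m≰b

length-descending-≰ : ∀ {m b} → ¬ m ≤ b →
  length (descending (suc m) (suc b)) ≡ length (descending (suc m) b) + length (descending m (suc b))
length-descending-≰ {m} {b} m≰b with m ≤? b
... | yes m≤b = contradiction m≤b m≰b
... | no  _   = trans (length-++ (descending (suc m) b))
                      (cong (λ k → length (descending (suc m) b) + k) (length-map (suc b ∷_) (descending m (suc b))))

-- The ballot recurrence, proved after multiplying both sides by m + 1.
ballot-step : ∀ b d P Q B₀ B₁ → let m = b + suc d in
  suc (suc m) * P ≡ suc (suc (suc d)) * B₀ → suc m * Q ≡ suc d * B₁ → suc b * B₁ ≡ suc m * B₀ →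
  suc (suc m) * (P + Q) ≡ suc (suc d) * (B₀ + B₁)
ballot-step b d P Q B₀ B₁ hP hQ hB = *-cancelˡ-≡ _ _ (suc m) (begin
  suc m * (suc (suc m) * (P + Q))                              ≡⟨ distrib m P Q ⟩
  suc m * (suc (suc m) * P) + suc (suc m) * (suc m * Q)        ≡⟨ cong₂ (λ x y → suc m * x + suc (suc m) * y) hP hQ ⟩
  suc m * (suc (suc (suc d)) * B₀) + suc (suc m) * (suc d * B₁) ≡⟨ swap m d B₀ B₁ ⟩
  suc (suc (suc d)) * (suc m * B₀) + suc (suc m) * (suc d * B₁) ≡⟨ cong (λ x → suc (suc (suc d)) * x + suc (suc m) * (suc d * B₁)) hB ⟨
  suc (suc (suc d)) * (suc b * B₁) + suc (suc m) * (suc d * B₁) ≡⟨ regroup b d B₁ ⟩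
  suc (suc d) * (suc b * B₁) + suc m * (suc (suc d) * B₁)       ≡⟨ cong (λ x → suc (suc d) * x + suc m * (suc (suc d) * B₁)) hB ⟩
  suc (suc d) * (suc m * B₀) + suc m * (suc (suc d) * B₁)       ≡⟨ factor m d B₀ B₁ ⟩
  suc m * (suc (suc d) * (B₀ + B₁))                            ∎)
  where
  open ≡-Reasoning
  m = b + suc d
  distrib : ∀ m P Q → suc m * (suc (suc m) * (P + Q)) ≡ suc m * (suc (suc m) * P) + suc (suc m) * (suc m * Q)
  distrib = solve-∀
  swap : ∀ m d B₀ B₁ → suc m * (suc (suc (suc d)) * B₀) + suc (suc m) * (suc d * B₁)
                     ≡ suc (suc (suc d)) * (suc m * B₀) + suc (suc m) * (suc d * B₁)
  swap = solve-∀
  regroup : ∀ b d B₁ → suc (suc (suc d)) * (suc b * B₁) + suc (suc (b + suc d)) * (suc d * B₁)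
                     ≡ suc (suc d) * (suc b * B₁) + suc (b + suc d) * (suc (suc d) * B₁)
  regroup = solve-∀
  factor : ∀ m d B₀ B₁ → suc (suc d) * (suc m * B₀) + suc m * (suc (suc d) * B₁) ≡ suc m * (suc (suc d) * (B₀ + B₁))
  factor = solve-∀

-- The ballot numbers (m + 1) · #descending m b = (m − b + 1) · C(m + b, b) for b ≤ m; m and N are
-- passed with equations so that the recursive calls need no rewriting.
length-descending : ∀ b d {m N} → m ≡ b + d → N ≡ b + m → suc m * length (descending m b) ≡ suc d * (N C b)
length-descending zero    d       {m} refl refl =
  cong (suc m *_) (length-descending-0 m)
length-descending (suc b) zero    refl refl = begin
  suc (suc (b + 0)) * length (descending (suc (b + 0)) (suc b))
    ≡⟨ cong (suc (suc (b + 0)) *_) (length-descending-≤ (≤-reflexive (+-identityʳ b))) ⟩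
  suc (suc (b + 0)) * length (descending (suc (b + 0)) b)
    ≡⟨ length-descending b 1 (trans (cong suc (+-identityʳ b)) (+-comm 1 b)) refl ⟩
  2 * (M C b)                     ≡⟨ cong (λ x → M C b + x) (+-identityʳ (M C b)) ⟩
  M C b + M C b                   ≡⟨ cong (λ x → M C b + x) ([k+r]Ck≡[k+r]Cr b (suc (b + 0))) ⟩
  M C b + M C suc (b + 0)         ≡⟨ cong (λ k → M C b + M C suc k) (+-identityʳ b) ⟩
  M C b + M C suc b               ≡⟨ nCk+nC[k+1]≡[n+1]C[k+1] M b ⟩
  suc M C suc b                   ≡⟨ +-identityʳ (suc M C suc b) ⟨
  1 * (suc M C suc b)             ∎
  where
  open ≡-Reasoning
  M = b + suc (b + 0)
length-descending (suc b) (suc d) refl refl = begin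
  suc (suc m) * length (descending (suc m) (suc b))
    ≡⟨ cong (suc (suc m) *_) (length-descending-≰ (m+1+n≰m b)) ⟩
  suc (suc m) * (length (descending (suc m) b) + length (descending m (suc b)))
    ≡⟨ ballot-step b d (length (descending (suc m) b)) (length (descending m (suc b))) (X C b) (X C suc b)
         (length-descending b (suc (suc d)) (sym (+-suc b (suc d))) refl)
         (length-descending (suc b) d (+-suc b d) (+-suc b m))
         ([k+1]*[k+r+1]C[k+1]≡[r+1]*[k+r+1]Ck b m) ⟩
  suc (suc d) * (X C b + X C suc b)  ≡⟨ cong (suc (suc d) *_) (nCk+nC[k+1]≡[n+1]C[k+1] X b) ⟩
  suc (suc d) * (suc X C suc b)      ∎
  where
  open ≡-Reasoning
  m = b + suc d
  X = b + suc m

length-descending-catalan : ∀ n → length (descending n n) ≡ ((2 * n) C n) / suc n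
length-descending-catalan n = sym (begin
  ((2 * n) C n) / suc n                  ≡⟨ cong (λ N → (N C n) / suc n) (cong (λ k → n + k) (+-identityʳ n)) ⟩
  ((n + n) C n) / suc n                  ≡⟨ cong (_/ suc n) (trans (length-descending n 0 (sym (+-identityʳ n)) refl) (*-identityˡ _)) ⟨
  (suc n * length (descending n n)) / suc n ≡⟨ cong (_/ suc n) (*-comm (suc n) (length (descending n n))) ⟩
  (length (descending n n) * suc n) / suc n ≡⟨ m*n/n≡m (length (descending n n)) (suc n) ⟩
  length (descending n n)                ∎)
  where open ≡-Reasoning

-- Sums of {0,1}-sequences and runs of ones

indicator : {P : Set} → Dec P → ℕ
indicator (yes _) = 1
indicator (no  _) = 0

indicator-yes : {P : Set} → P → (d : Dec P) → indicator d ≡ 1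
indicator-yes p (yes _) = refl
indicator-yes p (no ¬p) = contradiction p ¬p

indicator-no : {P : Set} → ¬ P → (d : Dec P) → indicator d ≡ 0
indicator-no ¬p (yes p) = contradiction p ¬p
indicator-no ¬p (no _)  = refl

indicator≤1 : {P : Set} (d : Dec P) → indicator d ≤ 1
indicator≤1 (yes _) = ≤-refl
indicator≤1 (no  _) = z≤n

sumℕ : ℕ → (ℕ → ℕ) → ℕ
sumℕ zero    f = 0
sumℕ (suc m) f = sumℕ m f + f (suc m)

sumℕ-zero : ∀ m → sumℕ m (λ _ → 0) ≡ 0
sumℕ-zero zero    = refl
sumℕ-zero (suc m) = trans (+-identityʳ _) (sumℕ-zero m)

sumℕ-one : ∀ m → sumℕ m (λ _ → 1) ≡ m
sumℕ-one zero    = refl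
sumℕ-one (suc m) = trans (cong (_+ 1) (sumℕ-one m)) (+-comm m 1)

sumℕ-cong : ∀ m {f g} → (∀ j → 1 ≤ j → j ≤ m → f j ≡ g j) → sumℕ m f ≡ sumℕ m g
sumℕ-cong zero    f≗g = refl
sumℕ-cong (suc m) f≗g = cong₂ _+_ (sumℕ-cong m (λ j 1≤j j≤m → f≗g j 1≤j (m≤n⇒m≤1+n j≤m))) (f≗g (suc m) (s≤s z≤n) ≤-refl)

sumℕ-+ : ∀ t m f → sumℕ (t + m) f ≡ sumℕ t f + sumℕ m (λ u → f (t + u))
sumℕ-+ t zero    f = trans (cong (λ k → sumℕ k f) (+-identityʳ t)) (sym (+-identityʳ (sumℕ t f)))
sumℕ-+ t (suc m) f = begin
  sumℕ (t + suc m) f                                 ≡⟨ cong (λ k → sumℕ k f) (+-suc t m) ⟩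
  sumℕ (t + m) f + f (suc (t + m))                   ≡⟨ cong₂ _+_ (sumℕ-+ t m f) (cong f (sym (+-suc t m))) ⟩
  sumℕ t f + sumℕ m (λ u → f (t + u)) + f (t + suc m) ≡⟨ +-assoc (sumℕ t f) _ _ ⟩
  sumℕ t f + sumℕ (suc m) (λ u → f (t + u))           ∎
  where open ≡-Reasoning

sumℕ≡0⇒≡0 : ∀ m f → sumℕ m f ≡ 0 → ∀ j → 1 ≤ j → j ≤ m → f j ≡ 0
sumℕ≡0⇒≡0 zero    f _   (suc j) _ ()
sumℕ≡0⇒≡0 (suc m) f Σ≡0 j 1≤j j≤1+m with m≤n⇒m<n∨m≡n j≤1+m
... | inj₁ (s≤s j≤m) = sumℕ≡0⇒≡0 m f (m+n≡0⇒m≡0 (sumℕ m f) Σ≡0) j 1≤j j≤m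
... | inj₂ refl      = m+n≡0⇒n≡0 (sumℕ m f) Σ≡0

sumℕ≡1⇒indicator : ∀ m f → (∀ j → 1 ≤ j → j ≤ m → f j ≤ 1) → sumℕ m f ≡ 1 →
  Σ ℕ λ u → 1 ≤ u × u ≤ m × (∀ j → 1 ≤ j → j ≤ m → f j ≡ indicator (j ≟ u))
sumℕ≡1⇒indicator zero    f _   ()
sumℕ≡1⇒indicator (suc m) f f≤1 Σ≡1 with f (suc m) in fm≡ | f≤1 (suc m) (s≤s z≤n) ≤-refl
... | 0 | _ with sumℕ≡1⇒indicator m f (λ j 1≤j j≤m → f≤1 j 1≤j (m≤n⇒m≤1+n j≤m)) (trans (sym (+-identityʳ _)) Σ≡1)
...   | u , 1≤u , u≤m , f≗ = u , 1≤u , m≤n⇒m≤1+n u≤m , extend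
  where
  extend : ∀ j → 1 ≤ j → j ≤ suc m → f j ≡ indicator (j ≟ u)
  extend j 1≤j j≤1+m with m≤n⇒m<n∨m≡n j≤1+m
  ... | inj₁ (s≤s j≤m) = f≗ j 1≤j j≤m
  ... | inj₂ refl      = trans fm≡ (sym (indicator-no (λ 1+m≡u → <⇒≱ (s≤s u≤m) (≤-reflexive 1+m≡u)) (suc m ≟ u)))
sumℕ≡1⇒indicator (suc m) f f≤1 Σ≡1 | 1 | _ = suc m , s≤s z≤n , ≤-refl , onlyTop
  where
  rest≡0 : sumℕ m f ≡ 0
  rest≡0 = +-cancelʳ-≡ 1 (sumℕ m f) 0 Σ≡1
  onlyTop : ∀ j → 1 ≤ j → j ≤ suc m → f j ≡ indicator (j ≟ suc m)
  onlyTop j 1≤j j≤1+m with m≤n⇒m<n∨m≡n j≤1+m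
  ... | inj₁ (s≤s j≤m) = trans (sumℕ≡0⇒≡0 m f rest≡0 j 1≤j j≤m) (sym (indicator-no (<⇒≢ (s≤s j≤m)) (j ≟ suc m)))
  ... | inj₂ refl      = trans fm≡ (sym (indicator-yes refl (suc m ≟ suc m)))
sumℕ≡1⇒indicator (suc m) f f≤1 Σ≡1 | suc (suc _) | s≤s ()

ones : ℕ → ℕ → ℕ → ℕ
ones i x j = indicator (j <? i) + indicator (j ≟ x)

module _ {i x : ℕ} (i≤x : i ≤ x) where

  ones-< : ∀ {j} → j < i → ones i x j ≡ 1
  ones-< {j} j<i = cong₂ _+_ (indicator-yes j<i (j <? i)) (indicator-no (<⇒≢ (≤-trans j<i i≤x)) (j ≟ x))

  ones-x : ones i x x ≡ 1
  ones-x = cong₂ _+_ (indicator-no (≤⇒≯ i≤x) (x <? i)) (indicator-yes refl (x ≟ x))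

  ones≤1 : ∀ j → ones i x j ≤ 1
  ones≤1 j with j <? i
  ... | yes j<i = ≤-reflexive (cong suc (indicator-no (<⇒≢ (≤-trans j<i i≤x)) (j ≟ x)))
  ... | no  _   = indicator≤1 (j ≟ x)

ones-> : ∀ {i x j} → ¬ j < i → j ≢ x → ones i x j ≡ 0
ones-> {i} {x} {j} j≮i j≢x = cong₂ _+_ (indicator-no j≮i (j <? i)) (indicator-no j≢x (j ≟ x))

indicator-≤-suc : ∀ x j → indicator (x ≤? j) + indicator (suc j ≟ x) ≡ indicator (x ≤? suc j)
indicator-≤-suc x j with x ≤? j | suc j ≟ x | x ≤? suc j
... | yes x≤j | yes refl | _        = contradiction x≤j (1+n≰n)
... | yes _   | no  _    | yes _    = refl
... | yes x≤j | no  _    | no  x≰1+j = contradiction (m≤n⇒m≤1+n x≤j) x≰1+j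
... | no  _   | yes refl | yes _    = refl
... | no  _   | yes refl | no  x≰x  = contradiction ≤-refl x≰x
... | no  x≰j | no  1+j≢x | yes x≤1+j = contradiction (sym (≤-antisym x≤1+j (≰⇒> x≰j))) 1+j≢x
... | no  _   | no  _    | no  _    = refl

sum-ones : ∀ {i x} j → suc i ≤ x → sumℕ j (ones (suc i) x) ≡ j ⊓ i + indicator (x ≤? j)
sum-ones {i} {x} zero    1+i≤x = sym (indicator-no (λ x≤0 → <⇒≱ (≤-trans (s≤s z≤n) 1+i≤x) x≤0) (x ≤? 0))
sum-ones {i} {x} (suc j) 1+i≤x with j <? i
... | yes j<i = begin
  sumℕ j (ones (suc i) x) + ones (suc i) x (suc j)  ≡⟨ cong₂ _+_ (sum-ones j 1+i≤x) (ones-< 1+i≤x (s≤s j<i)) ⟩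
  j ⊓ i + indicator (x ≤? j) + 1                   ≡⟨ cong₂ (λ a b → a + b + 1) (m≤n⇒m⊓n≡m (<⇒≤ j<i)) (indicator-no (<⇒≱ j<x) (x ≤? j)) ⟩
  j + 0 + 1                                        ≡⟨ +-comm (j + 0) 1 ⟩
  suc j + 0                                        ≡⟨ cong₂ _+_ (m≤n⇒m⊓n≡m j<i) (indicator-no (<⇒≱ 1+j<x) (x ≤? suc j)) ⟨
  suc j ⊓ i + indicator (x ≤? suc j)               ∎
  where
  open ≡-Reasoning
  1+j<x : suc j < x
  1+j<x = ≤-trans (s≤s j<i) 1+i≤x
  j<x : j < x
  j<x = <-trans (n<1+n j) 1+j<x
... | no  j≮i = begin
  sumℕ j (ones (suc i) x) + ones (suc i) x (suc j)
    ≡⟨ cong₂ _+_ (sum-ones j 1+i≤x) (cong (_+ indicator (suc j ≟ x)) (indicator-no (j≮i ∘ s≤s⁻¹) (suc j <? suc i))) ⟩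
  j ⊓ i + indicator (x ≤? j) + indicator (suc j ≟ x)    ≡⟨ cong (λ a → a + indicator (x ≤? j) + indicator (suc j ≟ x)) (m≥n⇒m⊓n≡n i≤j) ⟩
  i + indicator (x ≤? j) + indicator (suc j ≟ x)        ≡⟨ +-assoc i _ _ ⟩
  i + (indicator (x ≤? j) + indicator (suc j ≟ x))      ≡⟨ cong (λ k → i + k) (indicator-≤-suc x j) ⟩
  i + indicator (x ≤? suc j)                            ≡⟨ cong (_+ indicator (x ≤? suc j)) (m≥n⇒m⊓n≡n (m≤n⇒m≤1+n i≤j)) ⟨
  suc j ⊓ i + indicator (x ≤? suc j)                    ∎
  where
  open ≡-Reasoning
  i≤j : i ≤ j
  i≤j = ≮⇒≥ j≮i

⊓+indicator≤⊓suc : ∀ {i x} j → suc i ≤ x → j ⊓ i + indicator (x ≤? j) ≤ j ⊓ suc i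
⊓+indicator≤⊓suc {i} {x} j 1+i≤x with x ≤? j
... | yes x≤j = ≤-reflexive (begin
  j ⊓ i + 1      ≡⟨ cong₂ _+_ (m≥n⇒m⊓n≡n i≤j) refl ⟩
  i + 1          ≡⟨ +-comm i 1 ⟩
  suc i          ≡⟨ m≥n⇒m⊓n≡n 1+i≤j ⟨
  j ⊓ suc i      ∎)
  where
  open ≡-Reasoning
  1+i≤j = ≤-trans 1+i≤x x≤j
  i≤j = ≤-trans (n≤1+n i) 1+i≤j
... | no  _   = ≤-trans (≤-reflexive (+-identityʳ (j ⊓ i))) (⊓-monoʳ-≤ j (n≤1+n i))

sum-ones-mono : ∀ {i x x′} j → suc i ≤ x → suc (suc i) ≤ x′ →
  sumℕ j (ones (suc i) x) ≤ sumℕ j (ones (suc (suc i)) x′)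
sum-ones-mono {i} {x} {x′} j 1+i≤x 2+i≤x′ = begin
  sumℕ j (ones (suc i) x)                 ≡⟨ sum-ones j 1+i≤x ⟩
  j ⊓ i + indicator (x ≤? j)              ≤⟨ ⊓+indicator≤⊓suc j 1+i≤x ⟩
  j ⊓ suc i                               ≤⟨ m≤m+n (j ⊓ suc i) _ ⟩
  j ⊓ suc i + indicator (x′ ≤? j)          ≡⟨ sum-ones j 2+i≤x′ ⟨
  sumℕ j (ones (suc (suc i)) x′)          ∎
  where open ≤-Reasoning

sum-ones-at : ∀ {i x} → suc i ≤ x → sumℕ x (ones (suc i) x) + ones (suc i) x x ≡ suc (suc i)
sum-ones-at {i} {x} 1+i≤x = begin
  sumℕ x (ones (suc i) x) + ones (suc i) x x  ≡⟨ cong₂ _+_ (sum-ones x 1+i≤x) (ones-x 1+i≤x) ⟩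
  x ⊓ i + indicator (x ≤? x) + 1              ≡⟨ cong₂ (λ a b → a + b + 1) (m≥n⇒m⊓n≡n (≤-trans (n≤1+n i) 1+i≤x)) (indicator-yes ≤-refl (x ≤? x)) ⟩
  i + 1 + 1                                   ≡⟨ +-comm (i + 1) 1 ⟩
  suc (i + 1)                                 ≡⟨ cong suc (+-comm i 1) ⟩
  suc (suc i)                                 ∎
  where open ≡-Reasoning

sum-ones-after : ∀ {i x x′} → suc i ≤ x → suc (suc i) ≤ x′ →
  sumℕ (suc x) (ones (suc (suc i)) x′) ≡ suc i + indicator (x′ ≤? suc x)
sum-ones-after {i} {x} {x′} 1+i≤x 2+i≤x′ =
  trans (sum-ones (suc x) 2+i≤x′) (cong (_+ indicator (x′ ≤? suc x)) (m≥n⇒m⊓n≡n (s≤s (<⇒≤ 1+i≤x))))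

-- The magog inequality for two consecutive rows of ones, and its converse at column x.
ones-step : ∀ {i x x′} → suc i ≤ x → suc (suc i) ≤ x′ → x′ ≤ suc x →
  ∀ j → sumℕ j (ones (suc i) x) + ones (suc i) x j ≤ sumℕ (suc j) (ones (suc (suc i)) x′)
ones-step {i} {x} {x′} 1+i≤x 2+i≤x′ x′≤1+x j with x ≟ j
... | yes refl = ≤-reflexive (begin
  sumℕ x (ones (suc i) x) + ones (suc i) x x  ≡⟨ sum-ones-at 1+i≤x ⟩
  suc (suc i)                                 ≡⟨ +-comm 1 (suc i) ⟩
  suc i + 1                                   ≡⟨ cong (λ k → suc i + k) (indicator-yes x′≤1+x (x′ ≤? suc x)) ⟨
  suc i + indicator (x′ ≤? suc x)             ≡⟨ sum-ones-after 1+i≤x 2+i≤x′ ⟨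
  sumℕ (suc x) (ones (suc (suc i)) x′)        ∎)
  where open ≡-Reasoning
... | no x≢j with j ≤? i
...   | yes j≤i = begin
  sumℕ j (ones (suc i) x) + ones (suc i) x j  ≡⟨ cong₂ _+_ (sum-ones j 1+i≤x) (ones-< 1+i≤x (s≤s j≤i)) ⟩
  j ⊓ i + indicator (x ≤? j) + 1              ≡⟨ cong (λ b → j ⊓ i + b + 1) (indicator-no (<⇒≱ (≤-trans (s≤s j≤i) 1+i≤x)) (x ≤? j)) ⟩
  j ⊓ i + 0 + 1                               ≡⟨ +-comm (j ⊓ i + 0) 1 ⟩
  suc (j ⊓ i + 0)                             ≤⟨ s≤s (+-monoʳ-≤ (j ⊓ i) z≤n) ⟩
  suc j ⊓ suc i + indicator (x′ ≤? suc j)      ≡⟨ sum-ones (suc j) 2+i≤x′ ⟨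
  sumℕ (suc j) (ones (suc (suc i)) x′)        ∎
  where open ≤-Reasoning
...   | no j≰i = begin
  sumℕ j (ones (suc i) x) + ones (suc i) x j  ≡⟨ cong₂ _+_ (sum-ones j 1+i≤x) (ones-> (j≰i ∘ s≤s⁻¹) (x≢j ∘ sym)) ⟩
  j ⊓ i + indicator (x ≤? j) + 0              ≡⟨ +-identityʳ _ ⟩
  j ⊓ i + indicator (x ≤? j)                  ≤⟨ ⊓+indicator≤⊓suc j 1+i≤x ⟩
  j ⊓ suc i                                   ≤⟨ ⊓-monoˡ-≤ (suc i) (n≤1+n j) ⟩
  suc j ⊓ suc i                               ≤⟨ m≤m+n (suc j ⊓ suc i) _ ⟩
  suc j ⊓ suc i + indicator (x′ ≤? suc j)      ≡⟨ sum-ones (suc j) 2+i≤x′ ⟨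
  sumℕ (suc j) (ones (suc (suc i)) x′)        ∎
  where open ≤-Reasoning

ones-step⁻ : ∀ {i x x′} → suc i ≤ x → suc (suc i) ≤ x′ →
  sumℕ x (ones (suc i) x) + ones (suc i) x x ≤ sumℕ (suc x) (ones (suc (suc i)) x′) → x′ ≤ suc x
ones-step⁻ {i} {x} {x′} 1+i≤x 2+i≤x′ step with x′ ≤? suc x
... | yes x′≤1+x = x′≤1+x
... | no  x′≰1+x = contradiction
  (≤-trans (subst₂ _≤_ (sum-ones-at 1+i≤x) (sum-ones-after 1+i≤x 2+i≤x′) step)
           (≤-reflexive (cong (λ k → suc i + k) (indicator-no x′≰1+x (x′ ≤? suc x)))))
  (<⇒≱ (≤-reflexive (cong suc (+-identityʳ (suc i)))))

ones-≤ : ∀ {i j} → j ≤ i → ones i i j ≡ 1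
ones-≤ {i} j≤i with m≤n⇒m<n∨m≡n j≤i
... | inj₁ j<i = ones-< (≤-refl {i}) j<i
... | inj₂ refl = ones-x (≤-refl {i})

ones≡1⇒≡ : ∀ {i x j} → ¬ j < i → ones i x j ≡ 1 → j ≡ x
ones≡1⇒≡ {i} {x} {j} j≮i ones≡1 with x ≟ j
... | yes x≡j = sym x≡j
... | no  x≢j = contradiction (trans (sym (ones-> j≮i (x≢j ∘ sym))) ones≡1) 0≢1+n

ones-run : ∀ n t f → t ≤ n → (∀ j → 1 ≤ j → j ≤ n → f j ≤ 1) → (∀ j → 1 ≤ j → j ≤ t → f j ≡ 1) →
  sumℕ n f ≡ suc t → Σ ℕ λ x → suc t ≤ x × x ≤ n × (∀ j → 1 ≤ j → j ≤ n → f j ≡ ones (suc t) x j)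
ones-run n t f t≤n f≤1 run sum≡1+t
  with sumℕ≡1⇒indicator (n ∸ t) (λ w → f (t + w)) tail≤1 tail≡1
  where
  t+[n∸t]≡n = m+[n∸m]≡n t≤n
  tail≤1 : ∀ w → 1 ≤ w → w ≤ n ∸ t → f (t + w) ≤ 1
  tail≤1 w 1≤w w≤n∸t = f≤1 (t + w) (≤-trans 1≤w (m≤n+m w t)) (subst (t + w ≤_) t+[n∸t]≡n (+-monoʳ-≤ t w≤n∸t))
  tail≡1 : sumℕ (n ∸ t) (λ w → f (t + w)) ≡ 1
  tail≡1 = +-cancelˡ-≡ t _ 1 (begin
    t + sumℕ (n ∸ t) (λ w → f (t + w))        ≡⟨ cong (_+ sumℕ (n ∸ t) (λ w → f (t + w))) (trans (sumℕ-cong t run) (sumℕ-one t)) ⟨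
    sumℕ t f + sumℕ (n ∸ t) (λ w → f (t + w)) ≡⟨ sumℕ-+ t (n ∸ t) f ⟨
    sumℕ (t + (n ∸ t)) f                      ≡⟨ cong (λ k → sumℕ k f) t+[n∸t]≡n ⟩
    sumℕ n f                                  ≡⟨ sum≡1+t ⟩
    suc t                                     ≡⟨ +-comm 1 t ⟩
    t + 1                                     ∎)
    where open ≡-Reasoning
... | u , 1≤u , u≤n∸t , tail≗ = t + u , 1+t≤x , x≤n , f≗ones
  where
  x = t + u
  1+t≤x : suc t ≤ x
  1+t≤x = subst (_≤ x) (+-comm t 1) (+-monoʳ-≤ t 1≤u)
  x≤n : x ≤ n
  x≤n = subst (x ≤_) (m+[n∸m]≡n t≤n) (+-monoʳ-≤ t u≤n∸t)
  f≗ones : ∀ j → 1 ≤ j → j ≤ n → f j ≡ ones (suc t) x j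
  f≗ones j 1≤j j≤n with j ≤? t
  ... | yes j≤t = trans (run j 1≤j j≤t) (sym (ones-< 1+t≤x (s≤s j≤t)))
  ... | no  j≰t with x ≟ j
  ...   | yes refl = trans (tail≗ u 1≤u u≤n∸t) (trans (indicator-yes refl (u ≟ u)) (sym (ones-x 1+t≤x)))
  ...   | no  x≢j = begin
    f j                      ≡⟨ cong f t+w≡j ⟨
    f (t + w)                ≡⟨ tail≗ w 1≤w (∸-monoˡ-≤ t j≤n) ⟩
    indicator (w ≟ u)        ≡⟨ indicator-no (λ w≡u → x≢j (trans (cong (λ k → t + k) (sym w≡u)) t+w≡j)) (w ≟ u) ⟩
    0                        ≡⟨ ones-> (j≰t ∘ s≤s⁻¹) (x≢j ∘ sym) ⟨
    ones (suc t) x j         ∎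
    where
    open ≡-Reasoning
    w = j ∸ t
    t+w≡j = m+[n∸m]≡n (<⇒≤ (≰⇒> j≰t))
    1≤w = m<n⇒0<n∸m (≰⇒> j≰t)

-- Matrices given by their column partial sums

sumTo-cong : ∀ m {f g} → (∀ j → 1 ≤ j → j ≤ m → f j ≡ g j) → sumTo m f ≡ sumTo m g
sumTo-cong zero    f≗g = refl
sumTo-cong (suc m) f≗g = cong₂ _+ℤ_ (sumTo-cong m (λ j 1≤j j≤m → f≗g j 1≤j (m≤n⇒m≤1+n j≤m))) (f≗g (suc m) (s≤s z≤n) ≤-refl)

sumTo-+ : ∀ m f g → sumTo m (λ j → f j +ℤ g j) ≡ sumTo m f +ℤ sumTo m g
sumTo-+ zero    f g = refl
sumTo-+ (suc m) f g = trans (cong (_+ℤ (f (suc m) +ℤ g (suc m))) (sumTo-+ m f g)) (interchange (sumTo m f) (sumTo m g) (f (suc m)) (g (suc m)))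
  where
  interchange : ∀ a b c d → (a +ℤ b) +ℤ (c +ℤ d) ≡ (a +ℤ c) +ℤ (b +ℤ d)
  interchange = ℤ-Solver.solve-∀

sumTo-difference : ∀ m f g → sumTo m (λ j → f j -ℤ g j) ≡ sumTo m f -ℤ sumTo m g
sumTo-difference zero    f g = refl
sumTo-difference (suc m) f g = trans (cong (_+ℤ (f (suc m) -ℤ g (suc m))) (sumTo-difference m f g)) (interchange (sumTo m f) (sumTo m g) (f (suc m)) (g (suc m)))
  where
  interchange : ∀ a b c d → (a -ℤ b) +ℤ (c -ℤ d) ≡ (a +ℤ c) -ℤ (b +ℤ d)
  interchange = ℤ-Solver.solve-∀

sumTo≡+sumℕ : ∀ m f → sumTo m (λ j → + f j) ≡ + sumℕ m f
sumTo≡+sumℕ zero    f = refl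
sumTo≡+sumℕ (suc m) f = cong (_+ℤ + f (suc m)) (sumTo≡+sumℕ m f)

sumTo-zero : ∀ m → sumTo m (λ _ → + 0) ≡ + 0
sumTo-zero zero    = refl
sumTo-zero (suc m) = cong (_+ℤ + 0) (sumTo-zero m)

sumTo-one : ∀ m → sumTo m (λ _ → + 1) ≡ + m
sumTo-one zero    = refl
sumTo-one (suc m) = trans (cong (_+ℤ + 1) (sumTo-one m)) (cong +_ (+-comm m 1))

sumTo-swap : ∀ m k (f : ℕ → ℕ → ℤ) → sumTo m (λ j → sumTo k (λ l → f l j)) ≡ sumTo k (λ l → sumTo m (f l))
sumTo-swap m zero    f = sumTo-zero m
sumTo-swap m (suc k) f = trans (sumTo-+ m (λ j → sumTo k (λ l → f l j)) (f (suc k)))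
                               (cong (_+ℤ sumTo m (f (suc k))) (sumTo-swap m k f))

vecFrom : {A : Set} (m : ℕ) → ℕ → (ℕ → A) → Vec A m
vecFrom zero    k f = []
vecFrom (suc m) k f = f k ∷ vecFrom m (suc k) f

getD-vecFrom : ∀ {A : Set} m k f (d : A) {t} → t < m → getD d (vecFrom m k f) t ≡ f (k + t)
getD-vecFrom (suc m) k f d {zero}  _         = cong f (sym (+-identityʳ k))
getD-vecFrom (suc m) k f d {suc t} (s≤s t<m) = trans (getD-vecFrom m (suc k) f d t<m) (cong f (sym (+-suc k t)))

getD-ext : ∀ {A : Set} {m} (u v : Vec A m) (d : A) → (∀ t → t < m → getD d u t ≡ getD d v t) → u ≡ v
getD-ext []       []       d u≗v = refl
getD-ext (x ∷ u) (y ∷ v) d u≗v = cong₂ _∷_ (u≗v 0 (s≤s z≤n)) (getD-ext u v d (λ t t<m → u≗v (suc t) (s≤s t<m)))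

Matrix-ext : ∀ {n} (A B : Matrix n) → (∀ i j → 1 ≤ i → i ≤ n → 1 ≤ j → j ≤ n → entry A i j ≡ entry B i j) → A ≡ B
Matrix-ext {n} A B A≗B = getD-ext A B (replicate n (+ 0)) λ t t<n →
  getD-ext _ _ (+ 0) λ s s<n → A≗B (suc t) (suc s) (s≤s z≤n) t<n (s≤s z≤n) s<n

entry≡colPS-colPS : ∀ {n} (A : Matrix n) i j → entry A (suc i) j ≡ colPS A (suc i) j -ℤ colPS A i j
entry≡colPS-colPS A i j = sym (cancel (colPS A i j) (entry A (suc i) j))
  where
  cancel : ∀ x y → (x +ℤ y) -ℤ x ≡ y
  cancel = ℤ-Solver.solve-∀

fromColPS : (n : ℕ) → (ℕ → ℕ → ℕ) → Matrix n
fromColPS n c = vecFrom n 1 λ i → vecFrom n 1 λ j → + c i j -ℤ + c (pred i) j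

module _ (n : ℕ) (c : ℕ → ℕ → ℕ) where

  entry-fromColPS : ∀ {i j} → 1 ≤ i → i ≤ n → 1 ≤ j → j ≤ n → entry (fromColPS n c) i j ≡ + c i j -ℤ + c (pred i) j
  entry-fromColPS {suc i} {suc j} _ i<n _ j<n =
    trans (cong (λ row → getD (+ 0) row j) (getD-vecFrom n 1 _ (replicate n (+ 0)) i<n))
          (getD-vecFrom n 1 _ (+ 0) j<n)

  colPS-fromColPS : (∀ j → c 0 j ≡ 0) → ∀ {i j} → i ≤ n → 1 ≤ j → j ≤ n → colPS (fromColPS n c) i j ≡ + c i j
  colPS-fromColPS c₀≡0 {zero}  {j} _   _   _   = cong +_ (sym (c₀≡0 j))
  colPS-fromColPS c₀≡0 {suc i} {j} i<n 1≤j j≤n = begin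
    colPS (fromColPS n c) i j +ℤ entry (fromColPS n c) (suc i) j
      ≡⟨ cong₂ _+ℤ_ (colPS-fromColPS c₀≡0 (<⇒≤ i<n) 1≤j j≤n) (entry-fromColPS (s≤s z≤n) i<n 1≤j j≤n) ⟩
    + c i j +ℤ (+ c (suc i) j -ℤ + c i j)  ≡⟨ cancel (+ c i j) (+ c (suc i) j) ⟩
    + c (suc i) j                          ∎
    where
    open ≡-Reasoning
    cancel : ∀ x y → x +ℤ (y -ℤ x) ≡ y
    cancel = ℤ-Solver.solve-∀

  rowPS-fromColPS : ∀ {i j} → i < n → j ≤ n →
    rowPS (fromColPS n c) (suc i) j ≡ + sumℕ j (c (suc i)) -ℤ + sumℕ j (c i)
  rowPS-fromColPS {i} {j} i<n j≤n = begin
    sumTo j (entry (fromColPS n c) (suc i))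
      ≡⟨ sumTo-cong j (λ l 1≤l l≤j → entry-fromColPS (s≤s z≤n) i<n 1≤l (≤-trans l≤j j≤n)) ⟩
    sumTo j (λ l → + c (suc i) l -ℤ + c i l)                    ≡⟨ sumTo-difference j _ _ ⟩
    sumTo j (λ l → + c (suc i) l) -ℤ sumTo j (λ l → + c i l)   ≡⟨ cong₂ _-ℤ_ (sumTo≡+sumℕ j (c (suc i))) (sumTo≡+sumℕ j (c i)) ⟩
    + sumℕ j (c (suc i)) -ℤ + sumℕ j (c i)                      ∎
    where open ≡-Reasoning

-- Magog matrices from position sequences

EntriesIn0±1 : (n : ℕ) → Matrix n → Set
EntriesIn0±1 n A = (i j : ℕ) → 1 ≤ i → i ≤ n → 1 ≤ j → j ≤ n →
  (entry A i j ≡ + 0 ⊎ entry A i j ≡ + 1 ⊎ entry A i j ≡ -[1+ 0 ])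

RowSums≡1 : (n : ℕ) → Matrix n → Set
RowSums≡1 n A = (i : ℕ) → 1 ≤ i → i ≤ n → rowPS A i n ≡ + 1

ColumnSums≡1 : (n : ℕ) → Matrix n → Set
ColumnSums≡1 n A = (j : ℕ) → 1 ≤ j → j ≤ n → colPS A n j ≡ + 1

ColumnPartialSumsIn01 : (n : ℕ) → Matrix n → Set
ColumnPartialSumsIn01 n A = (i j : ℕ) → 1 ≤ i → i ≤ n → 1 ≤ j → j ≤ n →
  (+ 0 ≤ℤ colPS A i j) × (colPS A i j ≤ℤ + 1)

RowPartialSums≥0 : (n : ℕ) → Matrix n → Set
RowPartialSums≥0 n A = (i j : ℕ) → 1 ≤ i → i ≤ n → 1 ≤ j → j ≤ n → + 0 ≤ℤ rowPS A i j

MagogInequality : (n : ℕ) → Matrix n → Set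
MagogInequality n A = (i j : ℕ) → 1 ≤ i → i ≤ n ∸ 2 → 1 ≤ j → j ≤ n ∸ 2 →
  + 0 ≤ℤ ((rowPS A (suc i) j +ℤ colPS A (suc i) (suc j)) -ℤ colPS A i j)

IsMagog : (n : ℕ) → Matrix n → Set
IsMagog n A = EntriesIn0±1 n A × RowSums≡1 n A × ColumnSums≡1 n A
            × ColumnPartialSumsIn01 n A × RowPartialSums≥0 n A × MagogInequality n A

a₁₁≡1∨a₂₁≡1 : {n : ℕ} → Matrix n → Set
a₁₁≡1∨a₂₁≡1 A = entry A 1 1 ≡ + 1 ⊎ entry A 2 1 ≡ + 1

≤∸2⇒2+≤ : ∀ {i n} → 1 ≤ i → i ≤ n ∸ 2 → suc (suc i) ≤ n
≤∸2⇒2+≤ {suc i} {suc (suc n)} _ i≤n = s≤s (s≤s i≤n)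

2+≤⇒≤∸2 : ∀ {i n} → suc (suc i) ≤ n → i ≤ n ∸ 2
2+≤⇒≤∸2 (s≤s (s≤s i≤n)) = i≤n

+m-+n≡+[m∸n] : ∀ {m n} → n ≤ m → + m -ℤ + n ≡ + (m ∸ n)
+m-+n≡+[m∸n] {m} {n} n≤m = trans (ℤ.m-n≡m⊖n m n) (ℤ.⊖-≥ n≤m)

+a-+b∈0±1 : ∀ {a b} → a ≤ 1 → b ≤ 1 → (+ a -ℤ + b ≡ + 0 ⊎ + a -ℤ + b ≡ + 1 ⊎ + a -ℤ + b ≡ -[1+ 0 ])
+a-+b∈0±1 z≤n       z≤n       = inj₁ refl
+a-+b∈0±1 z≤n       (s≤s z≤n) = inj₂ (inj₂ refl)
+a-+b∈0±1 (s≤s z≤n) z≤n       = inj₂ (inj₁ refl)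
+a-+b∈0±1 (s≤s z≤n) (s≤s z≤n) = inj₁ refl

[a-b]+c-d≡[a+c]-[b+d] : ∀ a b c d → ((+ a -ℤ + b) +ℤ + c) -ℤ + d ≡ + (a + c) -ℤ + (b + d)
[a-b]+c-d≡[a+c]-[b+d] a b c d = regroup (+ a) (+ b) (+ c) (+ d)
  where
  regroup : ∀ w x y z → ((w -ℤ x) +ℤ y) -ℤ z ≡ (w +ℤ y) -ℤ (x +ℤ z)
  regroup = ℤ-Solver.solve-∀

Bounded : ℕ → (ℕ → ℕ) → Set
Bounded n X = ∀ i → 1 ≤ i → i ≤ n → i ≤ X i × X i ≤ n

StepBounded : ℕ → (ℕ → ℕ) → Set
StepBounded n X = ∀ i → 1 ≤ i → suc i ≤ n → X (suc i) ≤ suc (X i)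

colPSOf : (ℕ → ℕ) → ℕ → ℕ → ℕ
colPSOf X zero    j = 0
colPSOf X (suc i) j = ones (suc i) (X (suc i)) j

magogOf : (n : ℕ) → (ℕ → ℕ) → Matrix n
magogOf n X = fromColPS n (colPSOf X)

colPSOf≡ones : ∀ X {i} j → 1 ≤ i → colPSOf X i j ≡ ones i (X i) j
colPSOf≡ones X {suc i} j _ = refl

module _ {n : ℕ} {X : ℕ → ℕ} (bounded : Bounded n X) where

  private
    M = magogOf n X
    i<X : ∀ {i} → suc i ≤ n → suc i ≤ X (suc i)
    i<X 1+i≤n = proj₁ (bounded _ (s≤s z≤n) 1+i≤n)

  colPS-magogOf : ∀ {i j} → i ≤ n → 1 ≤ j → j ≤ n → colPS (magogOf n X) i j ≡ + colPSOf X i j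
  colPS-magogOf = colPS-fromColPS n (colPSOf X) (λ _ → refl)

  colPSOf≤1 : ∀ {i} j → i ≤ n → colPSOf X i j ≤ 1
  colPSOf≤1 {zero}  j _     = z≤n
  colPSOf≤1 {suc i} j 1+i≤n = ones≤1 (i<X 1+i≤n) j

  sum-colPSOf : ∀ {i} → i ≤ n → sumℕ n (colPSOf X i) ≡ i
  sum-colPSOf {zero}  _     = sumℕ-zero n
  sum-colPSOf {suc i} 1+i≤n = begin
    sumℕ n (ones (suc i) (X (suc i)))        ≡⟨ sum-ones n (i<X 1+i≤n) ⟩
    n ⊓ i + indicator (X (suc i) ≤? n)
      ≡⟨ cong₂ _+_ (m≥n⇒m⊓n≡n (<⇒≤ 1+i≤n)) (indicator-yes (proj₂ (bounded _ (s≤s z≤n) 1+i≤n)) (X (suc i) ≤? n)) ⟩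
    i + 1                                    ≡⟨ +-comm i 1 ⟩
    suc i                                    ∎
    where open ≡-Reasoning

  colPSOf-last : ∀ {j} → 1 ≤ j → j ≤ n → colPSOf X n j ≡ 1
  colPSOf-last {j} 1≤j j≤n = begin
    colPSOf X n j     ≡⟨ colPSOf≡ones X j 1≤n ⟩
    ones n (X n) j  ≡⟨ cong (λ x → ones n x j) (≤-antisym (proj₂ Xn-bounds) (proj₁ Xn-bounds)) ⟩
    ones n n j      ≡⟨ ones-≤ j≤n ⟩
    1               ∎
    where
    open ≡-Reasoning
    1≤n = ≤-trans 1≤j j≤n
    Xn-bounds = bounded n 1≤n ≤-refl

  sum-colPSOf-mono : ∀ {i} j → suc i ≤ n → sumℕ j (colPSOf X i) ≤ sumℕ j (colPSOf X (suc i))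
  sum-colPSOf-mono {zero}  j _     = ≤-trans (≤-reflexive (sumℕ-zero j)) z≤n
  sum-colPSOf-mono {suc i} j 2+i≤n = sum-ones-mono j (i<X (<⇒≤ 2+i≤n)) (i<X 2+i≤n)

  magogExpression-magogOf : ∀ {i j} → suc (suc i) ≤ n → 1 ≤ j → suc j ≤ n →
    (rowPS M (suc (suc i)) j +ℤ colPS M (suc (suc i)) (suc j)) -ℤ colPS M (suc i) j
      ≡ + sumℕ (suc j) (colPSOf X (suc (suc i))) -ℤ + (sumℕ j (colPSOf X (suc i)) + colPSOf X (suc i) j)
  magogExpression-magogOf {i} {j} 2+i≤n 1≤j 1+j≤n = begin
    (rowPS M (suc (suc i)) j +ℤ colPS M (suc (suc i)) (suc j)) -ℤ colPS M (suc i) j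
      ≡⟨ cong₂ (λ r c → (r +ℤ c) -ℤ colPS M (suc i) j)
               (rowPS-fromColPS n (colPSOf X) 2+i≤n (<⇒≤ 1+j≤n)) (colPS-magogOf 2+i≤n (s≤s z≤n) 1+j≤n) ⟩
    ((+ P₂ -ℤ + P₁) +ℤ + c₂) -ℤ colPS M (suc i) j
      ≡⟨ cong (((+ P₂ -ℤ + P₁) +ℤ + c₂) -ℤ_) (colPS-magogOf (<⇒≤ 2+i≤n) 1≤j (<⇒≤ 1+j≤n)) ⟩
    ((+ P₂ -ℤ + P₁) +ℤ + c₂) -ℤ + c₁  ≡⟨ [a-b]+c-d≡[a+c]-[b+d] P₂ P₁ c₂ c₁ ⟩
    + (P₂ + c₂) -ℤ + (P₁ + c₁)        ∎
    where
    open ≡-Reasoning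
    P₂ = sumℕ j (colPSOf X (suc (suc i)))
    P₁ = sumℕ j (colPSOf X (suc i))
    c₂ = colPSOf X (suc (suc i)) (suc j)
    c₁ = colPSOf X (suc i) j

  magogOf-isMagog : StepBounded n X → IsMagog n M
  magogOf-isMagog step = entries , rowSums , colSums , colPartialSums , rowPartialSums , inequality
    where
    entries : EntriesIn0±1 n M
    entries (suc i) j 1≤i i<n 1≤j j≤n rewrite entry-fromColPS n (colPSOf X) 1≤i i<n 1≤j j≤n =
      +a-+b∈0±1 (colPSOf≤1 j i<n) (colPSOf≤1 j (<⇒≤ i<n))
    rowSums : RowSums≡1 n M
    rowSums (suc i) _ i<n = begin
      rowPS M (suc i) n                             ≡⟨ rowPS-fromColPS n (colPSOf X) i<n ≤-refl ⟩
      + sumℕ n (colPSOf X (suc i)) -ℤ + sumℕ n (colPSOf X i) ≡⟨ cong₂ (λ a b → + a -ℤ + b) (sum-colPSOf i<n) (sum-colPSOf (<⇒≤ i<n)) ⟩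
      + suc i -ℤ + i                                ≡⟨ +m-+n≡+[m∸n] (n≤1+n i) ⟩
      + (suc i ∸ i)                                 ≡⟨ cong +_ (+-∸-assoc 1 (≤-refl {i})) ⟩
      + (1 + (i ∸ i))                               ≡⟨ cong (λ k → + suc k) (n∸n≡0 i) ⟩
      + 1                                           ∎
      where open ≡-Reasoning
    colSums : ColumnSums≡1 n M
    colSums j 1≤j j≤n = trans (colPS-magogOf ≤-refl 1≤j j≤n) (cong +_ (colPSOf-last 1≤j j≤n))
    colPartialSums : ColumnPartialSumsIn01 n M
    colPartialSums i j _ i≤n 1≤j j≤n rewrite colPS-magogOf i≤n 1≤j j≤n = +≤+ z≤n , +≤+ (colPSOf≤1 j i≤n)
    rowPartialSums : RowPartialSums≥0 n M
    rowPartialSums (suc i) j _ i<n _ j≤n rewrite rowPS-fromColPS n (colPSOf X) i<n j≤n =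
      ℤ.i≤j⇒0≤j-i (+≤+ (sum-colPSOf-mono j i<n))
    inequality : MagogInequality n M
    inequality (suc i) j _ i≤n∸2 1≤j j≤n∸2 =
      subst (+ 0 ≤ℤ_) (sym (magogExpression-magogOf 2+i≤n 1≤j (<⇒≤ 2+j≤n))) $ ℤ.i≤j⇒0≤j-i $ +≤+ $
        ones-step (i<X (<⇒≤ 2+i≤n)) (i<X 2+i≤n) (step (suc i) (s≤s z≤n) 2+i≤n) j
      where
      2+i≤n = ≤-trans (n≤1+n _) (≤∸2⇒2+≤ (s≤s z≤n) i≤n∸2)
      2+j≤n = ≤∸2⇒2+≤ 1≤j j≤n∸2

  magogOf-a₁₁≡1∨a₂₁≡1 : 1 ≤ n → a₁₁≡1∨a₂₁≡1 M
  magogOf-a₁₁≡1∨a₂₁≡1 1≤n with X 1 ≟ 1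
  ... | yes X₁≡1 = inj₁ (begin
    entry M 1 1             ≡⟨ entry-fromColPS n (colPSOf X) ≤-refl 1≤n ≤-refl 1≤n ⟩
    + ones 1 (X 1) 1 -ℤ + 0 ≡⟨ cong (λ x → + ones 1 x 1 -ℤ + 0) X₁≡1 ⟩
    + ones 1 1 1 -ℤ + 0     ≡⟨⟩
    + 1                     ∎)
    where open ≡-Reasoning
  ... | no  X₁≢1 = inj₂ (begin
    entry M 2 1                         ≡⟨ entry-fromColPS n (colPSOf X) (s≤s z≤n) 2≤n ≤-refl 1≤n ⟩
    + ones 2 (X 2) 1 -ℤ + ones 1 (X 1) 1 ≡⟨ cong₂ (λ a b → + a -ℤ + b) (ones-< (i<X 2≤n) (s≤s (s≤s z≤n))) (ones-> (<-irrefl refl) (X₁≢1 ∘ sym)) ⟩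
    + 1 -ℤ + 0                          ≡⟨⟩
    + 1                                 ∎)
    where
    open ≡-Reasoning
    2≤n = ≤-trans (≤∧≢⇒< (i<X 1≤n) (X₁≢1 ∘ sym)) (proj₂ (bounded 1 ≤-refl 1≤n))

  MagogInequality⇒StepBounded : MagogInequality n M → StepBounded n X
  MagogInequality⇒StepBounded inequality (suc i) _ 2+i≤n with n ≤? suc (X (suc i))
  ... | yes n≤1+x = ≤-trans (proj₂ (bounded _ (s≤s z≤n) 2+i≤n)) n≤1+x
  ... | no  n≰1+x = ones-step⁻ 1+i≤x (i<X 2+i≤n) $ ℤ.drop‿+≤+ $ ℤ.0≤i-j⇒j≤i $
      subst (+ 0 ≤ℤ_) (magogExpression-magogOf 2+i≤n 1≤x (<⇒≤ 2+x≤n))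
            (inequality (suc i) x (s≤s z≤n) (2+≤⇒≤∸2 (≤-trans (s≤s (s≤s 1+i≤x)) 2+x≤n)) 1≤x (2+≤⇒≤∸2 2+x≤n))
    where
    x = X (suc i)
    1+i≤x = i<X (<⇒≤ 2+i≤n)
    1≤x = ≤-trans (s≤s z≤n) 1+i≤x
    2+x≤n = ≰⇒> n≰1+x

magogOf-injective : ∀ {n X Y} → Bounded n X → Bounded n Y → magogOf n X ≡ magogOf n Y →
  ∀ i → 1 ≤ i → i ≤ n → X i ≡ Y i
magogOf-injective {n} {X} {Y} boundedX boundedY X≡Y i 1≤i i≤n =
  ones≡1⇒≡ (≤⇒≯ i≤Xi) $ ℤ.+-injective $ begin
    + ones i (Y i) (X i)         ≡⟨ cong +_ (colPSOf≡ones Y (X i) 1≤i) ⟨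
    + colPSOf Y i (X i)          ≡⟨ colPS-magogOf boundedY i≤n 1≤Xi Xi≤n ⟨
    colPS (magogOf n Y) i (X i)  ≡⟨ cong (λ A → colPS A i (X i)) X≡Y ⟨
    colPS (magogOf n X) i (X i)  ≡⟨ colPS-magogOf boundedX i≤n 1≤Xi Xi≤n ⟩
    + colPSOf X i (X i)          ≡⟨ cong +_ (trans (colPSOf≡ones X (X i) 1≤i) (ones-x i≤Xi)) ⟩
    + 1                          ∎
  where
  open ≡-Reasoning
  i≤Xi = proj₁ (boundedX i 1≤i i≤n)
  1≤Xi = ≤-trans 1≤i i≤Xi
  Xi≤n = proj₂ (boundedX i 1≤i i≤n)

magogOf-cong : ∀ {n X Y} → (∀ i → 1 ≤ i → i ≤ n → X i ≡ Y i) → magogOf n X ≡ magogOf n Y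
magogOf-cong {n} {X} {Y} X≗Y = Matrix-ext (magogOf n X) (magogOf n Y) λ i j 1≤i i≤n 1≤j j≤n → begin
  entry (magogOf n X) i j                    ≡⟨ entry-fromColPS n (colPSOf X) 1≤i i≤n 1≤j j≤n ⟩
  + colPSOf X i j -ℤ + colPSOf X (pred i) j  ≡⟨ cong₂ (λ a b → + a -ℤ + b) (colPSOf-cong j i≤n) (colPSOf-cong j (≤-trans pred[n]≤n i≤n)) ⟩
  + colPSOf Y i j -ℤ + colPSOf Y (pred i) j  ≡⟨ entry-fromColPS n (colPSOf Y) 1≤i i≤n 1≤j j≤n ⟨
  entry (magogOf n Y) i j                    ∎
  where
  open ≡-Reasoning
  colPSOf-cong : ∀ {i} j → i ≤ n → colPSOf X i j ≡ colPSOf Y i j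
  colPSOf-cong {zero}  j _     = refl
  colPSOf-cong {suc i} j 1+i≤n = cong (λ x → ones (suc i) x j) (X≗Y (suc i) (s≤s z≤n) 1+i≤n)

-- Reconstructing the position sequence of a magog matrix

module Reconstruction {n : ℕ} {A : Matrix n}
  (rowSums : RowSums≡1 n A) (colSums : ColumnSums≡1 n A) (colPartialSums : ColumnPartialSumsIn01 n A)
  (rowPartialSums : RowPartialSums≥0 n A) (inequality : MagogInequality n A) (a₁₁∨a₂₁ : a₁₁≡1∨a₂₁≡1 A) where

  OnesUpTo : ℕ → ℕ → Set
  OnesUpTo i k = ∀ l → 1 ≤ l → l ≤ k → colPS A i l ≡ + 1

  OnesUpTo-zero : ∀ {i} → OnesUpTo i 0
  OnesUpTo-zero l 1≤l l≤0 = contradiction (≤-trans 1≤l l≤0) λ ()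

  OnesUpTo-suc : ∀ {i k} → OnesUpTo i k → colPS A i (suc k) ≡ + 1 → OnesUpTo i (suc k)
  OnesUpTo-suc upToK next l 1≤l l≤1+k with m≤n⇒m<n∨m≡n l≤1+k
  ... | inj₁ (s≤s l≤k) = upToK l 1≤l l≤k
  ... | inj₂ refl      = next

  rowPS≡0 : ∀ {i k} → OnesUpTo (suc i) k → OnesUpTo i k → rowPS A (suc i) k ≡ + 0
  rowPS≡0 {i} {k} below above = trans
    (sumTo-cong k λ l 1≤l l≤k → trans (entry≡colPS-colPS A i l) (cong₂ _-ℤ_ (below l 1≤l l≤k) (above l 1≤l l≤k)))
    (sumTo-zero k)

  colPS≥1⇒≡1 : ∀ {i j} → 1 ≤ i → i ≤ n → 1 ≤ j → j ≤ n → + 1 ≤ℤ colPS A i j → colPS A i j ≡ + 1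
  colPS≥1⇒≡1 1≤i i≤n 1≤j j≤n = ℤ.≤-antisym (proj₂ (colPartialSums _ _ 1≤i i≤n 1≤j j≤n))

  entry₁≥0 : ∀ {i} → 1 ≤ i → i ≤ n → + 0 ≤ℤ entry A i 1
  entry₁≥0 1≤i i≤n = subst (+ 0 ≤ℤ_) (ℤ.+-identityˡ _) (rowPartialSums _ 1 1≤i i≤n ≤-refl (≤-trans 1≤i i≤n))

  colPS₂₁≡1 : 2 ≤ n → colPS A 2 1 ≡ + 1
  colPS₂₁≡1 2≤n = colPS≥1⇒≡1 (s≤s z≤n) 2≤n ≤-refl 1≤n lowerBound
    where
    1≤n = ≤-trans (s≤s z≤n) 2≤n
    lowerBound : + 1 ≤ℤ colPS A 1 1 +ℤ entry A 2 1
    lowerBound = [ (λ a₁₁≡1 → ℤ.+-mono-≤ (ℤ.≤-reflexive (sym (trans (ℤ.+-identityˡ _) a₁₁≡1))) (entry₁≥0 (s≤s z≤n) 2≤n))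
                 , (λ a₂₁≡1 → ℤ.+-mono-≤ (proj₁ (colPartialSums 1 1 ≤-refl 1≤n ≤-refl 1≤n)) (ℤ.≤-reflexive (sym a₂₁≡1)))
                 ]′ a₁₁∨a₂₁

  firstColumn : ∀ {i} → suc i ≤ n → colPS A i 1 ≡ + 1 → colPS A (suc i) 1 ≡ + 1
  firstColumn 1+i≤n cᵢ₁≡1 = colPS≥1⇒≡1 (s≤s z≤n) 1+i≤n ≤-refl (≤-trans (s≤s z≤n) 1+i≤n)
    (ℤ.+-mono-≤ (ℤ.≤-reflexive (sym cᵢ₁≡1)) (entry₁≥0 (s≤s z≤n) 1+i≤n))

  -- The magog inequality at (i, k) reads colPS A (suc i) (suc k) ≥ 1 once rowPS A (suc i) k = 0.
  nextColumn : ∀ {i k} → 1 ≤ i → i ≤ n ∸ 2 → 1 ≤ k → k ≤ n ∸ 2 →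
    OnesUpTo (suc i) k → OnesUpTo i k → colPS A (suc i) (suc k) ≡ + 1
  nextColumn {i} {k} 1≤i i≤n∸2 1≤k k≤n∸2 below above =
    colPS≥1⇒≡1 (s≤s z≤n) (<⇒≤ 2+i≤n) (s≤s z≤n) (<⇒≤ (≤∸2⇒2+≤ 1≤k k≤n∸2)) $ ℤ.0≤i-j⇒j≤i $
      subst (+ 0 ≤ℤ_) simplify (inequality i k 1≤i i≤n∸2 1≤k k≤n∸2)
    where
    2+i≤n = ≤∸2⇒2+≤ 1≤i i≤n∸2
    simplify : (rowPS A (suc i) k +ℤ colPS A (suc i) (suc k)) -ℤ colPS A i k ≡ colPS A (suc i) (suc k) -ℤ + 1
    simplify = trans (cong₂ (λ r c → (r +ℤ colPS A (suc i) (suc k)) -ℤ c) (rowPS≡0 below above) (above k 1≤k ≤-refl))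
                     (cong (_-ℤ + 1) (ℤ.+-identityˡ (colPS A (suc i) (suc k))))

  nextRow : ∀ {i} → 1 ≤ i → suc i ≤ n ∸ 2 → OnesUpTo (suc i) i → ∀ k → k ≤ suc i → OnesUpTo (suc (suc i)) k
  nextRow {i} 1≤i 1+i≤n∸2 above zero          _ = OnesUpTo-zero {suc (suc i)}
  nextRow {i} 1≤i 1+i≤n∸2 above (suc zero)    _ = OnesUpTo-suc {suc (suc i)} (OnesUpTo-zero {suc (suc i)})
    (firstColumn {suc i} (<⇒≤ (≤∸2⇒2+≤ (s≤s z≤n) 1+i≤n∸2)) (above 1 ≤-refl 1≤i))
  nextRow {i} 1≤i 1+i≤n∸2 above (suc (suc k)) 2+k≤1+i =
    let 1+k≤i     = s≤s⁻¹ 2+k≤1+i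
        below = nextRow 1≤i 1+i≤n∸2 above (suc k) (≤-trans (n≤1+n _) 2+k≤1+i)
    in OnesUpTo-suc {suc (suc i)} below
         (nextColumn {suc i} {suc k} (s≤s z≤n) 1+i≤n∸2 (s≤s z≤n) (≤-trans 1+k≤i (≤-trans (n≤1+n _) 1+i≤n∸2))
                     below (λ l 1≤l l≤1+k → above l 1≤l (≤-trans l≤1+k 1+k≤i)))

  leadingOnes-step : ∀ {i} → suc (suc (suc i)) ≤ n →
    OnesUpTo (suc (suc i)) (suc i) → OnesUpTo (suc (suc (suc i))) (suc (suc i))
  leadingOnes-step {i} 3+i≤n previous with suc (suc (suc i)) ≟ n
  ... | yes 3+i≡n = λ l 1≤l l≤2+i →
    subst (λ r → colPS A r l ≡ + 1) (sym 3+i≡n) (colSums l 1≤l (≤-trans (≤-trans l≤2+i (n≤1+n _)) 3+i≤n))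
  ... | no  3+i≢n = nextRow (s≤s z≤n) (2+≤⇒≤∸2 (≤∧≢⇒< 3+i≤n 3+i≢n)) previous (suc (suc i)) ≤-refl

  leadingOnes : ∀ i → suc i ≤ n → OnesUpTo (suc i) i
  leadingOnes zero          _     = OnesUpTo-zero {1}
  leadingOnes (suc zero)    2≤n   = OnesUpTo-suc {2} (OnesUpTo-zero {2}) (colPS₂₁≡1 2≤n)
  leadingOnes (suc (suc i)) 3+i≤n = leadingOnes-step 3+i≤n (leadingOnes (suc i) (<⇒≤ 3+i≤n))

  sum-colPS : ∀ {i} → i ≤ n → sumTo n (colPS A i) ≡ + i
  sum-colPS {i} i≤n = begin
    sumTo n (λ j → sumTo i (λ l → entry A l j))  ≡⟨ sumTo-swap n i (entry A) ⟩
    sumTo i (λ l → rowPS A l n)                  ≡⟨ sumTo-cong i (λ l 1≤l l≤i → rowSums l 1≤l (≤-trans l≤i i≤n)) ⟩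
    sumTo i (λ _ → + 1)                          ≡⟨ sumTo-one i ⟩
    + i                                          ∎
    where open ≡-Reasoning

  RowShape : ℕ → ℕ → Set
  RowShape i x = i ≤ x × x ≤ n × (∀ j → 1 ≤ j → j ≤ n → colPS A i j ≡ + ones i x j)

  rowShape : ∀ {t} → suc t ≤ n → Σ ℕ (RowShape (suc t))
  rowShape {t} 1+t≤n with ones-run n t (λ j → ∣ colPS A (suc t) j ∣) (<⇒≤ 1+t≤n) abs≤1 run sum≡1+t
    where
    +abs≡ : ∀ j → 1 ≤ j → j ≤ n → + ∣ colPS A (suc t) j ∣ ≡ colPS A (suc t) j
    +abs≡ j 1≤j j≤n = ℤ.0≤i⇒+∣i∣≡i (proj₁ (colPartialSums (suc t) j (s≤s z≤n) 1+t≤n 1≤j j≤n))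
    abs≤1 : ∀ j → 1 ≤ j → j ≤ n → ∣ colPS A (suc t) j ∣ ≤ 1
    abs≤1 j 1≤j j≤n = ℤ.drop‿+≤+ $ subst (_≤ℤ + 1) (sym (+abs≡ j 1≤j j≤n)) $
      proj₂ (colPartialSums (suc t) j (s≤s z≤n) 1+t≤n 1≤j j≤n)
    run : ∀ j → 1 ≤ j → j ≤ t → ∣ colPS A (suc t) j ∣ ≡ 1
    run j 1≤j j≤t = ℤ.+-injective (trans (+abs≡ j 1≤j (≤-trans j≤t (<⇒≤ 1+t≤n))) (leadingOnes t 1+t≤n j 1≤j j≤t))
    sum≡1+t : sumℕ n (λ j → ∣ colPS A (suc t) j ∣) ≡ suc t
    sum≡1+t = ℤ.+-injective (begin
      + sumℕ n (λ j → ∣ colPS A (suc t) j ∣)   ≡⟨ sumTo≡+sumℕ n _ ⟨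
      sumTo n (λ j → + ∣ colPS A (suc t) j ∣)  ≡⟨ sumTo-cong n +abs≡ ⟩
      sumTo n (colPS A (suc t))                ≡⟨ sum-colPS 1+t≤n ⟩
      + suc t                                  ∎)
      where open ≡-Reasoning
  ... | x , 1+t≤x , x≤n , abs≗ones = x , 1+t≤x , x≤n , λ j 1≤j j≤n →
    trans (sym (ℤ.0≤i⇒+∣i∣≡i (proj₁ (colPartialSums (suc t) j (s≤s z≤n) 1+t≤n 1≤j j≤n)))) (cong +_ (abs≗ones j 1≤j j≤n))

  position : ℕ → ℕ
  position zero    = 0
  position (suc t) with suc t ≤? n
  ... | yes 1+t≤n = proj₁ (rowShape 1+t≤n)
  ... | no  _     = 0

  position-rowShape : ∀ {t} → suc t ≤ n → RowShape (suc t) (position (suc t))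
  position-rowShape {t} 1+t≤n with suc t ≤? n
  ... | yes 1+t≤n′ = proj₂ (rowShape 1+t≤n′)
  ... | no  1+t≰n  = contradiction 1+t≤n 1+t≰n

  position-bounded : Bounded n position
  position-bounded (suc t) _ 1+t≤n = proj₁ (position-rowShape 1+t≤n) , proj₁ (proj₂ (position-rowShape 1+t≤n))

  colPS≡colPSOf : ∀ {i j} → i ≤ n → 1 ≤ j → j ≤ n → colPS A i j ≡ + colPSOf position i j
  colPS≡colPSOf {zero}  _     _   _   = refl
  colPS≡colPSOf {suc t} 1+t≤n 1≤j j≤n = proj₂ (proj₂ (position-rowShape 1+t≤n)) _ 1≤j j≤n

  entry≡entry-magogOf : ∀ i j → 1 ≤ i → i ≤ n → 1 ≤ j → j ≤ n → entry A i j ≡ entry (magogOf n position) i j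
  entry≡entry-magogOf (suc t) j 1≤i 1+t≤n 1≤j j≤n = begin
    entry A (suc t) j                                  ≡⟨ entry≡colPS-colPS A t j ⟩
    colPS A (suc t) j -ℤ colPS A t j                   ≡⟨ cong₂ _-ℤ_ (colPS≡colPSOf 1+t≤n 1≤j j≤n) (colPS≡colPSOf (<⇒≤ 1+t≤n) 1≤j j≤n) ⟩
    + colPSOf position (suc t) j -ℤ + colPSOf position t j ≡⟨ entry-fromColPS n (colPSOf position) 1≤i 1+t≤n 1≤j j≤n ⟨
    entry (magogOf n position) (suc t) j               ∎
    where open ≡-Reasoning

  A≡magogOf : A ≡ magogOf n position
  A≡magogOf = Matrix-ext A (magogOf n position) entry≡entry-magogOf

magog-reconstruction : ∀ {n} {A : Matrix n} → IsMagog n A → a₁₁≡1∨a₂₁≡1 A →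
  Σ (ℕ → ℕ) λ X → Bounded n X × StepBounded n X × A ≡ magogOf n X
magog-reconstruction {n} (_ , rowSums , colSums , colPartialSums , rowPartialSums , inequality) a₁₁∨a₂₁ =
  position , position-bounded , step , A≡magogOf
  where
  open Reconstruction rowSums colSums colPartialSums rowPartialSums inequality a₁₁∨a₂₁
  step = MagogInequality⇒StepBounded position-bounded (subst (MagogInequality n) A≡magogOf inequality)

-- Position sequences as descending sequences

nth : List ℕ → ℕ → ℕ
nth []       _       = 0
nth (y ∷ ys) zero    = y
nth (y ∷ ys) (suc t) = nth ys t

nth-applyUpTo : ∀ f m {t} → t < m → nth (applyUpTo f m) t ≡ f t
nth-applyUpTo f (suc m) {zero}  _         = refl
nth-applyUpTo f (suc m) {suc t} (s≤s t<m) = nth-applyUpTo (f ∘ suc) m t<m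

Descending-applyUpTo : ∀ m b f → (0 < m → f 0 ≤ b) → (∀ t → t < m → f t + suc t ≤ m) →
  (∀ t → suc t < m → f (suc t) ≤ f t) → Descending m b (applyUpTo f m)
Descending-applyUpTo zero    b f _     _     _    = refl
Descending-applyUpTo (suc m) b f first bound step =
  first (s≤s z≤n) ,
  s≤s⁻¹ (subst (_≤ suc m) (+-comm (f 0) 1) (bound 0 (s≤s z≤n))) ,
  Descending-applyUpTo m (f 0) (f ∘ suc)
    (λ 0<m → step 0 (s≤s 0<m))
    (λ t t<m → s≤s⁻¹ (subst (_≤ suc m) (+-suc (f (suc t)) (suc t)) (bound (suc t) (s≤s t<m))))
    (λ t 1+t<m → step (suc t) (s≤s 1+t<m))

Descending-nth-bound : ∀ {m b ys} → Descending m b ys → ∀ t → t < m → nth ys t + suc t ≤ m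
Descending-nth-bound {suc m} {ys = y ∷ ys} (_ , y≤m , _)    zero    _         = subst (_≤ suc m) (+-comm 1 y) (s≤s y≤m)
Descending-nth-bound {suc m} {ys = y ∷ ys} (_ , _ , rest)   (suc t) (s≤s t<m) =
  subst (_≤ suc m) (sym (+-suc (nth ys t) (suc t))) (s≤s (Descending-nth-bound rest t t<m))

Descending-nth-step : ∀ {m b ys} → Descending m b ys → ∀ t → suc t < m → nth ys (suc t) ≤ nth ys t
Descending-nth-step {suc (suc m)} {ys = y ∷ z ∷ ys} (_ , _ , z≤y , _)  zero    _           = z≤y
Descending-nth-step {suc m}       {ys = y ∷ ys}     (_ , _ , rest)    (suc t) (s≤s 1+t<m) = Descending-nth-step rest t 1+t<m

Descending-nth-ext : ∀ {m b b′ ys zs} → Descending m b ys → Descending m b′ zs →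
  (∀ t → t < m → nth ys t ≡ nth zs t) → ys ≡ zs
Descending-nth-ext {zero}  refl refl _ = refl
Descending-nth-ext {suc m} {ys = y ∷ ys} {z ∷ zs} (_ , _ , ys-rest) (_ , _ , zs-rest) ys≗zs =
  cong₂ _∷_ (ys≗zs 0 (s≤s z≤n)) (Descending-nth-ext ys-rest zs-rest (λ t t<m → ys≗zs (suc t) (s≤s t<m)))

-- A position sequence X is stored as its offsets (X 1 ∸ 1, …, X n ∸ n).
positions : List ℕ → ℕ → ℕ
positions ys i = nth ys (i ∸ 1) + i

offsets : ℕ → (ℕ → ℕ) → List ℕ
offsets n X = applyUpTo (λ t → X (suc t) ∸ suc t) n

module _ {n : ℕ} {ys : List ℕ} (ys↓ : Descending n n ys) where

  Descending⇒Bounded : Bounded n (positions ys)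
  Descending⇒Bounded (suc t) _ t<n = m≤n+m (suc t) (nth ys t) , Descending-nth-bound ys↓ t t<n

  Descending⇒StepBounded : StepBounded n (positions ys)
  Descending⇒StepBounded (suc t) _ 1+t<n =
    subst (_≤ suc (nth ys t + suc t)) (sym (+-suc (nth ys (suc t)) (suc t)))
          (s≤s (+-monoˡ-≤ (suc t) (Descending-nth-step ys↓ t 1+t<n)))

module _ {n : ℕ} {X : ℕ → ℕ} (bounded : Bounded n X) where

  positions-offsets : ∀ i → 1 ≤ i → i ≤ n → positions (offsets n X) i ≡ X i
  positions-offsets (suc t) 1≤i t<n =
    trans (cong (_+ suc t) (nth-applyUpTo _ n t<n)) (m∸n+n≡m (proj₁ (bounded (suc t) 1≤i t<n)))

  offsets-descending : StepBounded n X → Descending n n (offsets n X)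
  offsets-descending step = Descending-applyUpTo n n _
    (λ 0<n → ≤-trans (m∸n≤m (X 1) 1) (proj₂ (bounded 1 ≤-refl 0<n)))
    (λ t t<n → subst (_≤ n) (sym (m∸n+n≡m (proj₁ (bounded (suc t) (s≤s z≤n) t<n)))) (proj₂ (bounded (suc t) (s≤s z≤n) t<n)))
    (λ t 1+t<n → ∸-monoˡ-≤ (suc (suc t)) (step (suc t) (s≤s z≤n) 1+t<n))

Unique-map⁺ : ∀ {A B : Set} {f : A → B} {xs} → (∀ {x y} → x ∈ xs → y ∈ xs → f x ≡ f y → x ≡ y) →
  Unique xs → Unique (map f xs)
Unique-map⁺ injective []             = []
Unique-map⁺ injective (x∉xs ∷ xs!) =
  All.map⁺ (All.tabulate λ y∈xs fx≡fy → All.lookup x∉xs y∈xs (injective (here refl) (there y∈xs) fx≡fy)) ∷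
  Unique-map⁺ (λ x∈xs y∈xs → injective (there x∈xs) (there y∈xs)) xs!

magogs : (n : ℕ) → List (Matrix n)
magogs n = map (magogOf n ∘ positions) (descending n n)

magogs-unique : ∀ n → Unique (magogs n)
magogs-unique n = Unique-map⁺ injective (descending-unique n n)
  where
  injective : ∀ {ys zs} → ys ∈ descending n n → zs ∈ descending n n →
    magogOf n (positions ys) ≡ magogOf n (positions zs) → ys ≡ zs
  injective ys∈ zs∈ eq = Descending-nth-ext ys↓ zs↓ λ t t<n →
    +-cancelʳ-≡ (suc t) _ _ (magogOf-injective (Descending⇒Bounded ys↓) (Descending⇒Bounded zs↓) eq (suc t) (s≤s z≤n) t<n)
    where
    ys↓ = ∈-descending⁻ n n ys∈
    zs↓ = ∈-descending⁻ n n zs∈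

∈-magogs⇔ : ∀ {n} → 1 ≤ n → (A : Matrix n) → A ∈ magogs n ⇔ (IsMagog n A × a₁₁≡1∨a₂₁≡1 A)
∈-magogs⇔ {n} 1≤n A = mk⇔ magog reconstruct
  where
  magog : A ∈ magogs n → IsMagog n A × a₁₁≡1∨a₂₁≡1 A
  magog A∈ with ∈-map⁻ (magogOf n ∘ positions) A∈
  ... | ys , ys∈ , refl = magogOf-isMagog bounded (Descending⇒StepBounded ys↓) , magogOf-a₁₁≡1∨a₂₁≡1 bounded 1≤n
    where
    ys↓ = ∈-descending⁻ n n ys∈
    bounded = Descending⇒Bounded ys↓
  reconstruct : IsMagog n A × a₁₁≡1∨a₂₁≡1 A → A ∈ magogs n
  reconstruct (isMagog , a₁₁∨a₂₁) with magog-reconstruction isMagog a₁₁∨a₂₁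
  ... | X , bounded , step , refl =
    subst (_∈ magogs n) (magogOf-cong (positions-offsets bounded))
          (∈-map⁺ (magogOf n ∘ positions) (∈-descending⁺ n n (offsets-descending bounded step)))

length-magogs : ∀ n → length (magogs n) ≡ ((2 * n) C n) / suc n
length-magogs n = trans (length-map _ (descending n n)) (length-descending-catalan n)

lemma3p15 : (n : ℕ) → 1 ≤ n →
    Σ (List (Matrix n)) λ L →
      Unique L
      × ((A : Matrix n) →
          A ∈ L ⇔
            ((((i j : ℕ) → 1 ≤ i → i ≤ n → 1 ≤ j → j ≤ n →
                 (entry A i j ≡ + 0 ⊎ entry A i j ≡ + 1 ⊎ entry A i j ≡ -[1+ 0 ]))
              × ((i : ℕ) → 1 ≤ i → i ≤ n → rowPS A i n ≡ + 1)
              × ((j : ℕ) → 1 ≤ j → j ≤ n → colPS A n j ≡ + 1)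
              × ((i j : ℕ) → 1 ≤ i → i ≤ n → 1 ≤ j → j ≤ n →
                   (+ 0 ≤ℤ colPS A i j) × (colPS A i j ≤ℤ + 1))
              × ((i j : ℕ) → 1 ≤ i → i ≤ n → 1 ≤ j → j ≤ n →
                   + 0 ≤ℤ rowPS A i j)
              × ((i j : ℕ) → 1 ≤ i → i ≤ n ∸ 2 → 1 ≤ j → j ≤ n ∸ 2 →
                   + 0 ≤ℤ ((rowPS A (suc i) j +ℤ colPS A (suc i) (suc j)) -ℤ colPS A i j)))
             × (entry A 1 1 ≡ + 1 ⊎ entry A 2 1 ≡ + 1)))
      × length L ≡ ((2 * n) C n) / suc n
lemma3p15 n 1≤n = magogs n , magogs-unique n , ∈-magogs⇔ 1≤n , length-magogs n
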